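{- Let $(\alpha_n)_{n\ge0}$ be a sequence of complex numbers, $A_n(x)=\sum_{\nu=0}^{n}\binom{n}{\nu}\alpha_{n-\nu}x^\nu$, and assume $A_m(1-x)=(-1)^mA_m(x)$ for all $m\ge0$. Let $n\ge0$, $d_n=\lfloor n/2\rfloor$, $\delta_n=1$ if $n$ is odd and $\delta_n=0$ otherwise. Define for $0\le k\le d_n$ $$f_{n,k}=2^{2k-n}\sum_{\nu=0}^{d_n-k}\binom{n}{2\nu}\binom{d_n-\nu}{k}c_{2\nu},\qquad c_m=\sum_{j=0}^{m}\binom{m}{j}2^j\alpha_j,$$ and $F_n(u)=\sum_{k=0}^{d_n}f_{n,k}u^k$. Then $A_n(x)=(2x-1)^{\delta_n}F_n(x(x-1))$. Moreover $f_{n,0}=(-1)^n\alpha_n$ and $f_{n,d_n}=(\tfrac12)^{\delta_n}\alpha_0$. With $\phi=(1+\sqrt5)/2$, $A_n(\phi)=(\sqrt5)^{\delta_n}F_n(1)$, and $$\sum_{\nu=0}^{n}\binom{n}{\nu}\alpha_{n-\nu}\mathcal{F}_\nu=\begin{cases}2F_n(1),& n\text{ odd},\\0,& n\text{ even},\end{cases}$$ where $\mathcal{F}_\nu=(\phi^\nu-(1-\phi)^\nu)/\sqrt5$ are the Fibonacci numbers.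
   Context: $\alpha_0=0$ is allowed. -}

module Defs where

open import Level using (0ℓ)
open import Data.Nat as ℕ using (ℕ; zero; suc; _∸_; ⌊_/2⌋; _%_)
open import Data.Nat.Combinatorics using (_C_)
open import Data.Empty using (⊥)
open import Relation.Nullary using (¬_)
open import Algebra.Bundles using (CommutativeRing)

castℕ : (R : CommutativeRing 0ℓ 0ℓ) → ℕ → CommutativeRing.Carrier R
castℕ R zero    = CommutativeRing.0# R
castℕ R (suc n) = CommutativeRing._+_ R (CommutativeRing.1# R) (castℕ R n)

record Char0Field : Set₁ where
  field
    commRing : CommutativeRing 0ℓ 0ℓ
  open CommutativeRing commRing public

  fromℕ : ℕ → Carrier
  fromℕ = castℕ commRing

  field
    inv      : (x : Carrier) → ¬ (x ≈ 0#) → Carrier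
    inv-cor  : (x : Carrier) (p : ¬ (x ≈ 0#)) → x * inv x p ≈ 1#
    char0    : (n : ℕ) → ¬ (fromℕ (suc n) ≈ 0#)

module Theory (K : Char0Field) where
  open Char0Field K

  pow : Carrier → ℕ → Carrier
  pow x zero    = 1#
  pow x (suc n) = x * pow x n

  sumTo : ℕ → (ℕ → Carrier) → Carrier
  sumTo zero    f = f 0
  sumTo (suc n) f = sumTo n f + f (suc n)

  two : Carrier
  two = fromℕ 2

  half : Carrier
  half = inv two (char0 1)

  binom : ℕ → ℕ → Carrier
  binom n k = fromℕ (n C k)

  A : (ℕ → Carrier) → ℕ → Carrier → Carrier
  A α n x = sumTo n (λ ν → binom n ν * α (n ∸ ν) * pow x ν)

  d : ℕ → ℕ
  d n = ⌊ n /2⌋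

  δ : ℕ → ℕ
  δ n = n % 2

  c : (ℕ → Carrier) → ℕ → Carrier
  c α m = sumTo m (λ j → binom m j * pow two j * α j)

  -- f_{n,k} = 2^{2k-n} Σ_{ν=0}^{d_n-k} C(n,2ν) C(d_n-ν,k) c_{2ν}
  -- (for k ≤ d_n we have 2k ≤ n, so 2^{2k-n} = (1/2)^{n-2k})
  f : (ℕ → Carrier) → ℕ → ℕ → Carrier
  f α n k = pow half (n ∸ 2 ℕ.* k)
            * sumTo (d n ∸ k)
                (λ ν → binom n (2 ℕ.* ν) * binom (d n ∸ ν) k * c α (2 ℕ.* ν))

  F : (ℕ → Carrier) → ℕ → Carrier → Carrier
  F α n u = sumTo (d n) (λ k → f α n k * pow u k)

  -- φ = (1 + √5)/2, where s plays the role of √5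
  φ : Carrier → Carrier
  φ s = (1# + s) * half

  Fib : (s : Carrier) → ¬ (s ≈ 0#) → ℕ → Carrier
  Fib s s≉0 ν = (pow (φ s) ν - pow (1# - φ s) ν) * inv s s≉0

{-# OPTIONS --safe #-}
module Submission where

-- With c_m = 2^m A_m(1/2), the Appell structure of A gives the expansion about x = 1/2
--   2^n A_n(x) = Σ_i C(n,i) c_i (2x-1)^(n-i).
-- Symmetry at x = 1/2 forces A_m(1/2) = -A_m(1/2), hence c_m = 0, for odd m; so only the powers
-- (2x-1)^(n-2ν) = (2x-1)^δ ((2x-1)^2)^(d-ν) survive, and (2x-1)^2 = 4u + 1 with u = x(x-1).
-- Expanding (4u+1)^(d-ν) binomially and exchanging the two sums gives 2^n (2x-1)^δ F_n(u).
-- The other claims are evaluations of this identity: at x = 0, and at x = φ, where 2φ-1 = √5 and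
-- φ(φ-1) = 1; the Fibonacci sum is (A_n(φ) - A_n(1-φ))/√5 with A_n(1-φ) = (-1)^n A_n(φ).

open import Defs
open import Data.Nat as ℕ using (ℕ; zero; suc; _∸_; _%_; s≤s; ⌊_/2⌋)
open import Data.Product using (_×_; _,_)
open import Relation.Binary.PropositionalEquality as ≡ using (_≡_)
open import Relation.Nullary using (¬_)
import Data.Nat.Properties as ℕₚ
open import Data.Nat.Combinatorics using (_C_; nCn≡1; nCk≡nC[n∸k]; nCk+nC[k+1]≡[n+1]C[k+1])
open import Data.Nat.Combinatorics.Specification using (k>n⇒nCk≡0)
open import Data.Nat.DivMod using (m%n<n)
open import Data.Fin.Base using (Fin; toℕ)
import Algebra.Properties.Ring as RingProperties
import Algebra.Properties.AbelianGroup as AbelianGroupProperties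
import Algebra.Properties.CommutativeSemigroup as CommutativeSemigroupProperties
import Algebra.Properties.Semiring.Mult as SemiringMult
import Algebra.Properties.Semiring.Exp as SemiringExp
import Algebra.Properties.Semiring.Sum as SemiringSum
import Algebra.Properties.Semiring.Binomial as Binomial
import Algebra.Solver.Ring.NaturalCoefficients.Default as NaturalCoefficientsSolver
import Relation.Binary.Reasoning.Setoid as SetoidReasoning

-- Binomial coefficients and parity in ℕ

module _ where
  open import Data.Nat using (_+_; _*_; _≤_; _<_)
  open import Data.Nat.Properties
  open import Data.Nat.Tactic.RingSolver using (solve-∀)
  open import Relation.Binary.PropositionalEquality
  open import Relation.Nullary using (yes; no)

  nC[j+t]*[j+t]Cj≡nCj*[n∸j]Ct : ∀ n j t → (n C (j + t)) * ((j + t) C j) ≡ (n C j) * ((n ∸ j) C t)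
  nC[j+t]*[j+t]Cj≡nCj*[n∸j]Ct n       zero    t = *-comm (n C t) 1
  nC[j+t]*[j+t]Cj≡nCj*[n∸j]Ct zero    (suc j) t = refl
  nC[j+t]*[j+t]Cj≡nCj*[n∸j]Ct (suc n) (suc j) t = begin
      (suc n C suc (j + t)) * (suc (j + t) C suc j)
    ≡⟨ cong₂ _*_ (pascal n (j + t)) (pascal (j + t) j) ⟩
      (a + b) * (c + e)
    ≡⟨ distrib a b c e ⟩
      a * c + (a * e + b * (c + e))
    ≡⟨ cong₂ _+_ (nC[j+t]*[j+t]Cj≡nCj*[n∸j]Ct n j t)
                 (cong (a * e +_) (cong (b *_) (sym (pascal (j + t) j)))) ⟩
      (n C j) * ((n ∸ j) C t) + (a * e + (n C suc (j + t)) * (suc (j + t) C suc j))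
    ≡⟨ cong ((n C j) * ((n ∸ j) C t) +_) (new-subsets t) ⟩
      (n C j) * ((n ∸ j) C t) + (n C suc j) * ((n ∸ j) C t)
    ≡⟨ sym (*-distribʳ-+ ((n ∸ j) C t) (n C j) (n C suc j)) ⟩
      (n C j + n C suc j) * ((n ∸ j) C t)
    ≡⟨ cong (_* ((n ∸ j) C t)) (sym (pascal n j)) ⟩
      (suc n C suc j) * ((n ∸ j) C t)
    ∎
    where
    open ≡-Reasoning
    pascal : ∀ n k → suc n C suc k ≡ n C k + n C suc k
    pascal n k = sym (nCk+nC[k+1]≡[n+1]C[k+1] n k)
    distrib : ∀ a b c e → (a + b) * (c + e) ≡ a * c + (a * e + b * (c + e))
    distrib = solve-∀
    a b c e : ℕ
    a = n C (j + t)
    b = n C suc (j + t)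
    c = (j + t) C j
    e = (j + t) C suc j
    new-subsets : ∀ t → (n C (j + t)) * ((j + t) C suc j) + (n C suc (j + t)) * (suc (j + t) C suc j)
                      ≡ (n C suc j) * ((n ∸ j) C t)
    new-subsets zero rewrite +-identityʳ j | k>n⇒nCk≡0 (n<1+n j) | *-zeroʳ (n C j) =
      cong ((n C suc j) *_) (nCn≡1 (suc j))
    new-subsets (suc t) = begin
        (n C (j + suc t)) * ((j + suc t) C suc j) + (n C suc (j + suc t)) * (suc (j + suc t) C suc j)
      ≡⟨ cong₂ _+_ (trans (cong (λ m → (n C m) * (m C suc j)) (+-suc j t)) (nC[j+t]*[j+t]Cj≡nCj*[n∸j]Ct n (suc j) t))
                   (nC[j+t]*[j+t]Cj≡nCj*[n∸j]Ct n (suc j) (suc t)) ⟩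
        (n C suc j) * ((n ∸ suc j) C t) + (n C suc j) * ((n ∸ suc j) C suc t)
      ≡⟨ sym (*-distribˡ-+ (n C suc j) _ _) ⟩
        (n C suc j) * ((n ∸ suc j) C t + (n ∸ suc j) C suc t)
      ≡⟨ pascal-unless-vanishing ⟩
        (n C suc j) * ((n ∸ j) C suc t)
      ∎
      where
      pascal-unless-vanishing : (n C suc j) * ((n ∸ suc j) C t + (n ∸ suc j) C suc t) ≡ (n C suc j) * ((n ∸ j) C suc t)
      pascal-unless-vanishing with j <? n
      ... | yes j<n = cong ((n C suc j) *_)
                        (trans (sym (pascal (n ∸ suc j) t)) (cong (_C suc t) (sym (+-∸-assoc 1 j<n))))
      ... | no  j≮n rewrite k>n⇒nCk≡0 (s≤s (≮⇒≥ j≮n)) = refl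

  n≡n%2+2*⌊n/2⌋ : ∀ n → n ≡ n % 2 + 2 * ⌊ n /2⌋
  n≡n%2+2*⌊n/2⌋ zero          = refl
  n≡n%2+2*⌊n/2⌋ (suc zero)    = refl
  n≡n%2+2*⌊n/2⌋ (suc (suc n)) = trans (cong (2 +_) (n≡n%2+2*⌊n/2⌋ n)) (shift (n % 2) ⌊ n /2⌋)
    where
    shift : ∀ r q → 2 + (r + 2 * q) ≡ r + 2 * suc q
    shift = solve-∀

  n%2≤1 : ∀ n → n % 2 ≤ 1
  n%2≤1 n = ≤-pred (m%n<n n 2)

  n∸2*⌊n/2⌋≡n%2 : ∀ n → n ∸ 2 * ⌊ n /2⌋ ≡ n % 2
  n∸2*⌊n/2⌋≡n%2 n = trans (cong (_∸ 2 * ⌊ n /2⌋) (n≡n%2+2*⌊n/2⌋ n)) (m+n∸n≡m (n % 2) (2 * ⌊ n /2⌋))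

  n∸2*ν≡n%2+2*[⌊n/2⌋∸ν] : ∀ n {ν} → ν ≤ ⌊ n /2⌋ → n ∸ 2 * ν ≡ n % 2 + 2 * (⌊ n /2⌋ ∸ ν)
  n∸2*ν≡n%2+2*[⌊n/2⌋∸ν] n {ν} ν≤d = begin
      n ∸ 2 * ν
    ≡⟨ cong (_∸ 2 * ν) (n≡n%2+2*⌊n/2⌋ n) ⟩
      n % 2 + 2 * ⌊ n /2⌋ ∸ 2 * ν
    ≡⟨ +-∸-assoc (n % 2) (*-monoʳ-≤ 2 ν≤d) ⟩
      n % 2 + (2 * ⌊ n /2⌋ ∸ 2 * ν)
    ≡⟨ cong (n % 2 +_) (sym (*-distribˡ-∸ 2 ⌊ n /2⌋ ν)) ⟩
      n % 2 + 2 * (⌊ n /2⌋ ∸ ν)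
    ∎
    where open ≡-Reasoning

  ν≤⌊n/2⌋⇒2*ν≤n : ∀ n {ν} → ν ≤ ⌊ n /2⌋ → 2 * ν ≤ n
  ν≤⌊n/2⌋⇒2*ν≤n n {ν} ν≤d = ≤-trans (*-monoʳ-≤ 2 ν≤d)
    (subst (2 * ⌊ n /2⌋ ≤_) (sym (n≡n%2+2*⌊n/2⌋ n)) (m≤n+m _ (n % 2)))

  1+n≤2*[1+⌊n/2⌋] : ∀ n → suc n ≤ 2 * suc ⌊ n /2⌋
  1+n≤2*[1+⌊n/2⌋] n = subst (_≤ 2 * suc ⌊ n /2⌋) (cong suc (sym (n≡n%2+2*⌊n/2⌋ n)))
    (subst (suc (n % 2 + 2 * ⌊ n /2⌋) ≤_) (sym (*-suc 2 ⌊ n /2⌋)) (s≤s (+-monoˡ-≤ (2 * ⌊ n /2⌋) (n%2≤1 n))))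

  m∸k<ν⇒m∸ν<k : ∀ {m k ν} → ν ≤ m → m ∸ k < ν → m ∸ ν < k
  m∸k<ν⇒m∸ν<k {m} {k} {ν} ν≤m m∸k<ν = ∸-cancelʳ-< (subst (m ∸ k <_) (sym (m∸[m∸n]≡n ν≤m)) m∸k<ν)

module _ (K : Char0Field) where
  open Char0Field K
  open Theory K
  open RingProperties ring using (-1*x≈-x; -‿involutive; -‿+-comm; x[y-z]≈xy-xz)
  open AbelianGroupProperties +-abelianGroup using (∙-cancelʳ)
  open CommutativeSemigroupProperties +-commutativeSemigroup using () renaming (interchange to +-interchange)
  open CommutativeSemigroupProperties *-commutativeSemigroup
    using (x∙yz≈y∙xz; x∙yz≈y∙zx; xy∙z≈xz∙y) renaming (interchange to *-interchange)
  open SemiringMult semiring using (×-congʳ; ×-assoc-*; ×1-homo-*) renaming (_×_ to _×ₙ_)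
  open SemiringExp semiring using (_^_)
  module Fin∑ = SemiringSum semiring
  open NaturalCoefficientsSolver commutativeSemiring using (solve; _:+_; _:*_; _:=_; con)
  open SetoidReasoning setoid

  pow-congˡ : ∀ n {x y} → x ≈ y → pow x n ≈ pow y n
  pow-congˡ zero    x≈y = refl
  pow-congˡ (suc n) x≈y = *-cong x≈y (pow-congˡ n x≈y)

  pow-+ : ∀ x m n → pow x (m ℕ.+ n) ≈ pow x m * pow x n
  pow-+ x zero    n = sym (*-identityˡ _)
  pow-+ x (suc m) n = trans (*-congˡ (pow-+ x m n)) (sym (*-assoc x _ _))

  pow-∸ : ∀ x {j n} → j ℕ.≤ n → pow x n ≈ pow x j * pow x (n ∸ j)
  pow-∸ x {j} j≤n = trans (reflexive (≡.cong (pow x) (≡.sym (ℕₚ.m+[n∸m]≡n j≤n)))) (pow-+ x j _)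

  pow-distrib-* : ∀ x y n → pow (x * y) n ≈ pow x n * pow y n
  pow-distrib-* x y zero    = sym (*-identityˡ 1#)
  pow-distrib-* x y (suc n) = trans (*-congˡ (pow-distrib-* x y n)) (*-interchange x y _ _)

  pow-2* : ∀ x n → pow x (2 ℕ.* n) ≈ pow (x * x) n
  pow-2* x n = begin
      pow x (2 ℕ.* n)
    ≡⟨ ≡.cong (λ m → pow x (n ℕ.+ m)) (ℕₚ.+-identityʳ n) ⟩
      pow x (n ℕ.+ n)
    ≈⟨ pow-+ x n n ⟩
      pow x n * pow x n
    ≈⟨ pow-distrib-* x x n ⟨
      pow (x * x) n
    ∎

  1^n≈1 : ∀ n → pow 1# n ≈ 1#
  1^n≈1 zero    = refl
  1^n≈1 (suc n) = trans (*-identityˡ _) (1^n≈1 n)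

  -1*-1≈1 : - 1# * - 1# ≈ 1#
  -1*-1≈1 = trans (-1*x≈-x (- 1#)) (-‿involutive 1#)

  [-1]^[2*m]≈1 : ∀ m → pow (- 1#) (2 ℕ.* m) ≈ 1#
  [-1]^[2*m]≈1 m = trans (pow-2* (- 1#) m) (trans (pow-congˡ m -1*-1≈1) (1^n≈1 m))

  [-1]^k*[-1]^k≈1 : ∀ k → pow (- 1#) k * pow (- 1#) k ≈ 1#
  [-1]^k*[-1]^k≈1 k = trans (sym (pow-distrib-* (- 1#) (- 1#) k)) (trans (pow-congˡ k -1*-1≈1) (1^n≈1 k))

  [-1]^n≈[-1]^δn : ∀ n → pow (- 1#) n ≈ pow (- 1#) (δ n)
  [-1]^n≈[-1]^δn n = begin
      pow (- 1#) n
    ≡⟨ ≡.cong (pow (- 1#)) (n≡n%2+2*⌊n/2⌋ n) ⟩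
      pow (- 1#) (δ n ℕ.+ 2 ℕ.* d n)
    ≈⟨ pow-+ (- 1#) (δ n) (2 ℕ.* d n) ⟩
      pow (- 1#) (δ n) * pow (- 1#) (2 ℕ.* d n)
    ≈⟨ *-congˡ ([-1]^[2*m]≈1 (d n)) ⟩
      pow (- 1#) (δ n) * 1#
    ≈⟨ *-identityʳ _ ⟩
      pow (- 1#) (δ n)
    ∎

  two*half≈1 : two * half ≈ 1#
  two*half≈1 = inv-cor two (char0 1)

  two≈1+1 : two ≈ 1# + 1#
  two≈1+1 = +-congˡ (+-identityʳ 1#)

  x+x≈two*x : ∀ x → x + x ≈ two * x
  x+x≈two*x x = begin
      x + x
    ≈⟨ +-cong (*-identityˡ x) (*-identityˡ x) ⟨
      1# * x + 1# * x
    ≈⟨ distribʳ x 1# 1# ⟨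
      (1# + 1#) * x
    ≈⟨ *-congʳ two≈1+1 ⟨
      two * x
    ∎

  half*[two*x]≈x : ∀ x → half * (two * x) ≈ x
  half*[two*x]≈x x = begin
      half * (two * x)
    ≈⟨ *-assoc half two x ⟨
      half * two * x
    ≈⟨ *-congʳ (trans (*-comm half two) two*half≈1) ⟩
      1# * x
    ≈⟨ *-identityˡ x ⟩
      x
    ∎

  two*-cancelˡ : ∀ {x y} → two * x ≈ two * y → x ≈ y
  two*-cancelˡ {x} {y} eq = trans (sym (half*[two*x]≈x x)) (trans (*-congˡ eq) (half*[two*x]≈x y))

  two^n*-cancelˡ : ∀ n {x y} → pow two n * x ≈ pow two n * y → x ≈ y
  two^n*-cancelˡ zero    eq = trans (sym (*-identityˡ _)) (trans eq (*-identityˡ _))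
  two^n*-cancelˡ (suc n) eq =
    two^n*-cancelˡ n (two*-cancelˡ (trans (sym (*-assoc two _ _)) (trans eq (*-assoc two _ _))))

  two^n*half^n≈1 : ∀ n → pow two n * pow half n ≈ 1#
  two^n*half^n≈1 n = trans (sym (pow-distrib-* two half n)) (trans (pow-congˡ n two*half≈1) (1^n≈1 n))

  1-half≈half : 1# - half ≈ half
  1-half≈half = begin
      1# - half
    ≈⟨ +-congʳ (trans (sym two*half≈1) (sym (x+x≈two*x half))) ⟩
      (half + half) - half
    ≈⟨ +-assoc half half (- half) ⟩
      half + (half - half)
    ≈⟨ +-congˡ (-‿inverseʳ half) ⟩
      half + 0#
    ≈⟨ +-identityʳ half ⟩
      half
    ∎

  x≈-x⇒x≈0 : ∀ {x} → x ≈ - x → x ≈ 0#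
  x≈-x⇒x≈0 {x} x≈-x = two*-cancelˡ (begin
      two * x
    ≈⟨ x+x≈two*x x ⟨
      x + x
    ≈⟨ +-congˡ x≈-x ⟩
      x - x
    ≈⟨ -‿inverseʳ x ⟩
      0#
    ≈⟨ zeroʳ two ⟨
      two * 0#
    ∎)

  [two*x-1]^2≈4x[x-1]+1 : ∀ x → (two * x - 1#) * (two * x - 1#) ≈ two * two * (x * (x - 1#)) + 1#
  [two*x-1]^2≈4x[x-1]+1 x = begin
      (two * x - 1#) * (two * x - 1#)
    ≈⟨ *-cong (+-congʳ (*-congʳ two≈1+1)) (+-congʳ (*-congʳ two≈1+1)) ⟩
      -- the solver reads con 2 as 1# + 1#, which is not definitionally two
      ((1# + 1#) * x - 1#) * ((1# + 1#) * x - 1#)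
    ≈⟨ solve 2 (λ x m → (con 2 :* x :+ m) :* (con 2 :* x :+ m) := con 2 :* con 2 :* (x :* (x :+ m)) :+ m :* m)
         refl x (- 1#) ⟩
      (1# + 1#) * (1# + 1#) * (x * (x - 1#)) + - 1# * - 1#
    ≈⟨ +-cong (*-congʳ (sym (*-cong two≈1+1 two≈1+1))) -1*-1≈1 ⟩
      two * two * (x * (x - 1#)) + 1#
    ∎

  -- Finite sums

  ∑< : ℕ → (ℕ → Carrier) → Carrier
  ∑< zero    f = 0#
  ∑< (suc n) f = ∑< n f + f n

  syntax ∑< n (λ i → x) = ∑[ i < n ] x

  sumTo≈∑ : ∀ n f → sumTo n f ≈ ∑< (suc n) f
  sumTo≈∑ zero    f = sym (+-identityˡ _)
  sumTo≈∑ (suc n) f = +-congʳ (sumTo≈∑ n f)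

  sumTo-cong : ∀ n {f g} → (∀ i → f i ≈ g i) → sumTo n f ≈ sumTo n g
  sumTo-cong zero    f≈g = f≈g 0
  sumTo-cong (suc n) f≈g = +-cong (sumTo-cong n f≈g) (f≈g (suc n))

  ∑-cong : ∀ n {f g} → (∀ i → i ℕ.< n → f i ≈ g i) → ∑< n f ≈ ∑< n g
  ∑-cong zero    f≈g = refl
  ∑-cong (suc n) f≈g = +-cong (∑-cong n (λ i i<n → f≈g i (ℕₚ.m<n⇒m<1+n i<n))) (f≈g n (ℕₚ.n<1+n n))

  ∑-zero : ∀ n {f} → (∀ i → i ℕ.< n → f i ≈ 0#) → ∑< n f ≈ 0#
  ∑-zero zero    f≈0 = refl
  ∑-zero (suc n) f≈0 =
    trans (+-cong (∑-zero n (λ i i<n → f≈0 i (ℕₚ.m<n⇒m<1+n i<n))) (f≈0 n (ℕₚ.n<1+n n))) (+-identityˡ 0#)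

  ∑-distrib-+ : ∀ n f g → ∑[ i < n ] (f i + g i) ≈ ∑< n f + ∑< n g
  ∑-distrib-+ zero    f g = sym (+-identityˡ 0#)
  ∑-distrib-+ (suc n) f g = trans (+-congʳ (∑-distrib-+ n f g)) (+-interchange _ _ _ _)

  ∑[f-g]≈∑f-∑g : ∀ n f g → ∑[ i < n ] (f i - g i) ≈ ∑< n f - ∑< n g
  ∑[f-g]≈∑f-∑g zero    f g = sym (-‿inverseʳ 0#)
  ∑[f-g]≈∑f-∑g (suc n) f g = begin
      ∑[ i < n ] (f i - g i) + (f n - g n)
    ≈⟨ +-congʳ (∑[f-g]≈∑f-∑g n f g) ⟩
      (∑< n f - ∑< n g) + (f n - g n)
    ≈⟨ +-interchange _ _ _ _ ⟩
      (∑< n f + f n) + (- ∑< n g - g n)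
    ≈⟨ +-congˡ (-‿+-comm (∑< n g) (g n)) ⟩
      (∑< n f + f n) - (∑< n g + g n)
    ∎

  *-distribˡ-∑ : ∀ n x f → x * ∑< n f ≈ ∑[ i < n ] (x * f i)
  *-distribˡ-∑ zero    x f = zeroʳ x
  *-distribˡ-∑ (suc n) x f = trans (distribˡ x _ _) (+-congʳ (*-distribˡ-∑ n x f))

  *-distribʳ-∑ : ∀ n x f → ∑< n f * x ≈ ∑[ i < n ] (f i * x)
  *-distribʳ-∑ zero    x f = zeroˡ x
  *-distribʳ-∑ (suc n) x f = trans (distribʳ x _ _) (+-congʳ (*-distribʳ-∑ n x f))

  ∑-head : ∀ n f → ∑< (suc n) f ≈ f 0 + ∑[ i < n ] f (suc i)
  ∑-head zero    f = trans (+-identityˡ _) (sym (+-identityʳ _))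
  ∑-head (suc n) f = trans (+-congʳ (∑-head n f)) (+-assoc _ _ _)

  ∑-split : ∀ m k f → ∑< (m ℕ.+ k) f ≈ ∑< m f + ∑[ t < k ] f (m ℕ.+ t)
  ∑-split m zero    f rewrite ℕₚ.+-identityʳ m = sym (+-identityʳ _)
  ∑-split m (suc k) f rewrite ℕₚ.+-suc m k = trans (+-congʳ (∑-split m k f)) (+-assoc _ _ _)

  ∑-extend : ∀ {m n} f → m ℕ.≤ n → (∀ i → m ℕ.≤ i → i ℕ.< n → f i ≈ 0#) → ∑< n f ≈ ∑< m f
  ∑-extend {m} {n} f m≤n f≈0 = begin
      ∑< n f
    ≡⟨ ≡.cong (λ k → ∑< k f) (ℕₚ.m+[n∸m]≡n m≤n) ⟨
      ∑< (m ℕ.+ (n ∸ m)) f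
    ≈⟨ ∑-split m (n ∸ m) f ⟩
      ∑< m f + ∑[ t < n ∸ m ] f (m ℕ.+ t)
    ≈⟨ +-congˡ (∑-zero (n ∸ m) (λ t t<n∸m → f≈0 (m ℕ.+ t) (ℕₚ.m≤m+n m t)
         (≡.subst (m ℕ.+ t ℕ.<_) (ℕₚ.m+[n∸m]≡n m≤n) (ℕₚ.+-monoʳ-< m t<n∸m)))) ⟩
      ∑< m f + 0#
    ≈⟨ +-identityʳ _ ⟩
      ∑< m f
    ∎

  ∑-comm : ∀ m n (g : ℕ → ℕ → Carrier) → ∑[ i < m ] ∑< n (g i) ≈ ∑[ j < n ] ∑[ i < m ] g i j
  ∑-comm zero    n g = sym (∑-zero n (λ _ _ → refl))
  ∑-comm (suc m) n g = trans (+-congʳ (∑-comm m n g)) (sym (∑-distrib-+ n _ (g m)))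

  ∑-reverse : ∀ n f → ∑< n f ≈ ∑[ i < n ] f (n ∸ suc i)
  ∑-reverse zero    f = refl
  ∑-reverse (suc n) f = begin
      ∑< n f + f n
    ≈⟨ +-congʳ (∑-reverse n f) ⟩
      ∑[ i < n ] f (n ∸ suc i) + f n
    ≈⟨ +-comm _ _ ⟩
      f n + ∑[ i < n ] f (n ∸ suc i)
    ≈⟨ ∑-head n (λ i → f (n ∸ i)) ⟨
      ∑[ i < suc n ] f (n ∸ i)
    ∎

  ∑-pairs : ∀ m f → ∑< (2 ℕ.* m) f ≈ ∑[ ν < m ] (f (2 ℕ.* ν) + f (suc (2 ℕ.* ν)))
  ∑-pairs zero    f = refl
  ∑-pairs (suc m) f = begin
      ∑< (2 ℕ.* suc m) f
    ≡⟨ ≡.cong (λ k → ∑< k f) (ℕₚ.*-suc 2 m) ⟩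
      ∑< (2 ℕ.* m) f + f (2 ℕ.* m) + f (suc (2 ℕ.* m))
    ≈⟨ +-assoc _ _ _ ⟩
      ∑< (2 ℕ.* m) f + (f (2 ℕ.* m) + f (suc (2 ℕ.* m)))
    ≈⟨ +-congʳ (∑-pairs m f) ⟩
      ∑[ ν < suc m ] (f (2 ℕ.* ν) + f (suc (2 ℕ.* ν)))
    ∎

  fromℕ≡×1 : ∀ m → fromℕ m ≡ m ×ₙ 1#
  fromℕ≡×1 zero    = ≡.refl
  fromℕ≡×1 (suc m) = ≡.cong (1# +_) (fromℕ≡×1 m)

  fromℕ-homo-* : ∀ m n → fromℕ (m ℕ.* n) ≈ fromℕ m * fromℕ n
  fromℕ-homo-* m n rewrite fromℕ≡×1 (m ℕ.* n) | fromℕ≡×1 m | fromℕ≡×1 n = ×1-homo-* m n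

  fromℕ*x≈m×x : ∀ m x → fromℕ m * x ≈ m ×ₙ x
  fromℕ*x≈m×x m x rewrite fromℕ≡×1 m = trans (×-assoc-* m 1# x) (×-congʳ m (*-identityˡ x))

  binom-n-n : ∀ n → binom n n ≈ 1#
  binom-n-n n = trans (reflexive (≡.cong fromℕ (nCn≡1 n))) (+-identityʳ 1#)

  binom-vanishes : ∀ {n k} → n ℕ.< k → binom n k ≈ 0#
  binom-vanishes n<k = reflexive (≡.cong fromℕ (k>n⇒nCk≡0 n<k))

  binom-sym : ∀ {n k} → k ℕ.≤ n → binom n (n ∸ k) ≈ binom n k
  binom-sym k≤n = reflexive (≡.cong fromℕ (≡.sym (nCk≡nC[n∸k] k≤n)))

  binom-subset : ∀ n j t → binom n (j ℕ.+ t) * binom (j ℕ.+ t) j ≈ binom n j * binom (n ∸ j) t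
  binom-subset n j t = begin
      binom n (j ℕ.+ t) * binom (j ℕ.+ t) j
    ≈⟨ fromℕ-homo-* (n C (j ℕ.+ t)) ((j ℕ.+ t) C j) ⟨
      fromℕ ((n C (j ℕ.+ t)) ℕ.* ((j ℕ.+ t) C j))
    ≡⟨ ≡.cong fromℕ (nC[j+t]*[j+t]Cj≡nCj*[n∸j]Ct n j t) ⟩
      fromℕ ((n C j) ℕ.* ((n ∸ j) C t))
    ≈⟨ fromℕ-homo-* (n C j) ((n ∸ j) C t) ⟩
      binom n j * binom (n ∸ j) t
    ∎

  pow≡^ : ∀ x n → pow x n ≡ x ^ n
  pow≡^ x zero    = ≡.refl
  pow≡^ x (suc n) = ≡.cong (x *_) (pow≡^ x n)

  ∑≈Fin∑ : ∀ n f → ∑< n f ≈ Fin∑.sum (λ (i : Fin n) → f (toℕ i))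
  ∑≈Fin∑ zero    f = refl
  ∑≈Fin∑ (suc n) f = trans (∑-head n f) (+-congˡ (∑≈Fin∑ n (λ i → f (suc i))))

  binomial : ∀ x y n → pow (x + y) n ≈ ∑[ k < suc n ] (binom n k * (pow x k * pow y (n ∸ k)))
  binomial x y n = begin
      pow (x + y) n
    ≡⟨ pow≡^ (x + y) n ⟩
      (x + y) ^ n
    ≈⟨ Binomial.theorem semiring x y (*-comm x y) n ⟩
      Fin∑.sum {suc n} (λ k → (n C toℕ k) ×ₙ (x ^ toℕ k * y ^ (n ∸ toℕ k)))
    ≈⟨ Fin∑.sum-cong-≋ {suc n} (λ k → term (toℕ k)) ⟨
      Fin∑.sum {suc n} (λ k → binom n (toℕ k) * (pow x (toℕ k) * pow y (n ∸ toℕ k)))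
    ≈⟨ ∑≈Fin∑ (suc n) _ ⟨
      ∑[ k < suc n ] (binom n k * (pow x k * pow y (n ∸ k)))
    ∎
    where
    term : ∀ k → binom n k * (pow x k * pow y (n ∸ k)) ≈ (n C k) ×ₙ (x ^ k * y ^ (n ∸ k))
    term k rewrite pow≡^ x k | pow≡^ y (n ∸ k) = fromℕ*x≈m×x (n C k) _

  [1+z]^n≈∑ : ∀ z n → pow (1# + z) n ≈ ∑[ t < suc n ] (binom n t * pow z (n ∸ t))
  [1+z]^n≈∑ z n = trans (binomial 1# z n)
    (∑-cong (suc n) (λ t _ → *-congˡ (trans (*-congʳ (1^n≈1 t)) (*-identityˡ _))))

  [x+1]^n≈∑ : ∀ x n → pow (x + 1#) n ≈ ∑[ k < suc n ] (binom n k * pow x k)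
  [x+1]^n≈∑ x n = trans (binomial x 1# n)
    (∑-cong (suc n) (λ k _ → *-congˡ (trans (*-congˡ (1^n≈1 (n ∸ k))) (*-identityʳ _))))

  ∑-binom*binom*pow : ∀ z n {j} → j ℕ.≤ n →
    ∑[ i < suc n ] (binom n i * binom i j * pow z (n ∸ i)) ≈ binom n j * pow (1# + z) (n ∸ j)
  ∑-binom*binom*pow z n {j} j≤n = begin
      ∑< (suc n) G
    ≡⟨ ≡.cong (λ m → ∑< m G) size ⟩
      ∑< (j ℕ.+ suc (n ∸ j)) G
    ≈⟨ ∑-split j (suc (n ∸ j)) G ⟩
      ∑< j G + ∑[ t < suc (n ∸ j) ] G (j ℕ.+ t)
    ≈⟨ +-cong (∑-zero j (λ i i<j → trans (*-congʳ (trans (*-congˡ (binom-vanishes i<j)) (zeroʳ _))) (zeroˡ _)))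
              (∑-cong (suc (n ∸ j)) (λ t _ → term t)) ⟩
      0# + ∑[ t < suc (n ∸ j) ] (binom n j * (binom (n ∸ j) t * pow z (n ∸ j ∸ t)))
    ≈⟨ +-identityˡ _ ⟩
      ∑[ t < suc (n ∸ j) ] (binom n j * (binom (n ∸ j) t * pow z (n ∸ j ∸ t)))
    ≈⟨ *-distribˡ-∑ (suc (n ∸ j)) _ _ ⟨
      binom n j * ∑[ t < suc (n ∸ j) ] (binom (n ∸ j) t * pow z (n ∸ j ∸ t))
    ≈⟨ *-congˡ ([1+z]^n≈∑ z (n ∸ j)) ⟨
      binom n j * pow (1# + z) (n ∸ j)
    ∎
    where
    G : ℕ → Carrier
    G i = binom n i * binom i j * pow z (n ∸ i)
    size : suc n ≡ j ℕ.+ suc (n ∸ j)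
    size = ≡.trans (≡.cong suc (≡.sym (ℕₚ.m+[n∸m]≡n j≤n))) (≡.sym (ℕₚ.+-suc j (n ∸ j)))
    term : ∀ t → G (j ℕ.+ t) ≈ binom n j * (binom (n ∸ j) t * pow z (n ∸ j ∸ t))
    term t = begin
        binom n (j ℕ.+ t) * binom (j ℕ.+ t) j * pow z (n ∸ (j ℕ.+ t))
      ≈⟨ *-cong (binom-subset n j t) (reflexive (≡.cong (pow z) (≡.sym (ℕₚ.∸-+-assoc n j t)))) ⟩
        binom n j * binom (n ∸ j) t * pow z (n ∸ j ∸ t)
      ≈⟨ *-assoc _ _ _ ⟩
        binom n j * (binom (n ∸ j) t * pow z (n ∸ j ∸ t))
      ∎

  ∑-pow*∑-binom : ∀ D v (w : ℕ → Carrier) →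
    ∑[ k < suc D ] (pow v k * ∑[ ν < suc D ] (w ν * binom (D ∸ ν) k))
      ≈ ∑[ ν < suc D ] (w ν * pow (v + 1#) (D ∸ ν))
  ∑-pow*∑-binom D v w = begin
      ∑[ k < suc D ] (pow v k * ∑[ ν < suc D ] (w ν * binom (D ∸ ν) k))
    ≈⟨ ∑-cong (suc D) (λ k _ → *-distribˡ-∑ (suc D) (pow v k) _) ⟩
      ∑[ k < suc D ] ∑[ ν < suc D ] (pow v k * (w ν * binom (D ∸ ν) k))
    ≈⟨ ∑-comm (suc D) (suc D) _ ⟩
      ∑[ ν < suc D ] ∑[ k < suc D ] (pow v k * (w ν * binom (D ∸ ν) k))
    ≈⟨ ∑-cong (suc D) (λ ν _ → inner ν) ⟩
      ∑[ ν < suc D ] (w ν * pow (v + 1#) (D ∸ ν))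
    ∎
    where
    inner : ∀ ν → ∑[ k < suc D ] (pow v k * (w ν * binom (D ∸ ν) k)) ≈ w ν * pow (v + 1#) (D ∸ ν)
    inner ν = begin
        ∑[ k < suc D ] (pow v k * (w ν * binom (D ∸ ν) k))
      ≈⟨ ∑-cong (suc D) (λ k _ → x∙yz≈y∙zx (pow v k) (w ν) _) ⟩
        ∑[ k < suc D ] (w ν * (binom (D ∸ ν) k * pow v k))
      ≈⟨ *-distribˡ-∑ (suc D) (w ν) _ ⟨
        w ν * ∑[ k < suc D ] (binom (D ∸ ν) k * pow v k)
      ≈⟨ *-congˡ (∑-extend _ (s≤s (ℕₚ.m∸n≤m D ν))
           (λ k D∸ν<k _ → trans (*-congʳ (binom-vanishes D∸ν<k)) (zeroˡ _))) ⟩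
        w ν * ∑[ k < suc (D ∸ ν) ] (binom (D ∸ ν) k * pow v k)
      ≈⟨ *-congˡ ([x+1]^n≈∑ v (D ∸ ν)) ⟨
        w ν * pow (v + 1#) (D ∸ ν)
      ∎

  -- The golden ratio

  two*φ-1≈s : ∀ s → two * φ s - 1# ≈ s
  two*φ-1≈s s = begin
      two * ((1# + s) * half) - 1#
    ≈⟨ +-congʳ (x∙yz≈y∙xz two (1# + s) half) ⟩
      (1# + s) * (two * half) - 1#
    ≈⟨ +-congʳ (trans (*-congˡ two*half≈1) (*-identityʳ _)) ⟩
      (1# + s) - 1#
    ≈⟨ +-congʳ (+-comm 1# s) ⟩
      (s + 1#) - 1#
    ≈⟨ +-assoc s 1# (- 1#) ⟩
      s + (1# - 1#)
    ≈⟨ +-congˡ (-‿inverseʳ 1#) ⟩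
      s + 0#
    ≈⟨ +-identityʳ s ⟩
      s
    ∎

  φ*[φ-1]≈1 : ∀ {s} → s * s ≈ fromℕ 5 → φ s * (φ s - 1#) ≈ 1#
  φ*[φ-1]≈1 {s} s*s≈5 = two*-cancelˡ (two*-cancelˡ (∙-cancelʳ 1# _ _ (begin
      two * (two * (φ s * (φ s - 1#))) + 1#
    ≈⟨ +-congʳ (*-assoc two two _) ⟨
      two * two * (φ s * (φ s - 1#)) + 1#
    ≈⟨ [two*x-1]^2≈4x[x-1]+1 (φ s) ⟨
      (two * φ s - 1#) * (two * φ s - 1#)
    ≈⟨ *-cong (two*φ-1≈s s) (two*φ-1≈s s) ⟩
      s * s
    ≈⟨ s*s≈5 ⟩
      1# + fromℕ (2 ℕ.* 2)
    ≈⟨ +-congˡ (fromℕ-homo-* 2 2) ⟩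
      1# + two * two
    ≈⟨ +-comm 1# _ ⟩
      two * two + 1#
    ≈⟨ +-congʳ (*-congˡ (*-identityʳ two)) ⟨
      two * (two * 1#) + 1#
    ∎)))

  module _ (α : ℕ → Carrier) where

    A-congʳ : ∀ n {x y} → x ≈ y → A α n x ≈ A α n y
    A-congʳ n x≈y = sumTo-cong n (λ ν → *-congˡ (pow-congˡ ν x≈y))

    F-congʳ : ∀ n {u v} → u ≈ v → F α n u ≈ F α n v
    F-congʳ n u≈v = sumTo-cong (d n) (λ k → *-congˡ (pow-congˡ k u≈v))

    A-reversed : ∀ n x → A α n x ≈ ∑[ j < suc n ] (binom n j * α j * pow x (n ∸ j))
    A-reversed n x = begin
        A α n x
      ≈⟨ sumTo≈∑ n _ ⟩
        ∑[ ν < suc n ] (binom n ν * α (n ∸ ν) * pow x ν)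
      ≈⟨ ∑-reverse (suc n) _ ⟩
        ∑[ j < suc n ] (binom n (n ∸ j) * α (n ∸ (n ∸ j)) * pow x (n ∸ j))
      ≈⟨ ∑-cong (suc n) (λ j j<1+n → *-congʳ (*-cong (binom-sym (ℕₚ.≤-pred j<1+n))
           (reflexive (≡.cong α (ℕₚ.m∸[m∸n]≡n (ℕₚ.≤-pred j<1+n)))))) ⟩
        ∑[ j < suc n ] (binom n j * α j * pow x (n ∸ j))
      ∎

    A-at-0 : ∀ n → A α n 0# ≈ α n
    A-at-0 n = begin
        A α n 0#
      ≈⟨ sumTo≈∑ n _ ⟩
        ∑[ ν < suc n ] (binom n ν * α (n ∸ ν) * pow 0# ν)
      ≈⟨ ∑-head n _ ⟩
        binom n 0 * α n * 1# + ∑[ ν < n ] (binom n (suc ν) * α (n ∸ suc ν) * (0# * pow 0# ν))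
      ≈⟨ +-cong (trans (*-identityʳ _) (trans (*-congʳ (+-identityʳ 1#)) (*-identityˡ _)))
                (∑-zero n (λ ν _ → trans (*-congˡ (zeroˡ _)) (zeroʳ _))) ⟩
        α n + 0#
      ≈⟨ +-identityʳ _ ⟩
        α n
      ∎

    F-at-0 : ∀ n → F α n 0# ≈ f α n 0
    F-at-0 n = begin
        F α n 0#
      ≈⟨ sumTo≈∑ (d n) _ ⟩
        ∑[ k < suc (d n) ] (f α n k * pow 0# k)
      ≈⟨ ∑-head (d n) _ ⟩
        f α n 0 * 1# + ∑[ k < d n ] (f α n (suc k) * (0# * pow 0# k))
      ≈⟨ +-cong (*-identityʳ _) (∑-zero (d n) (λ k _ → trans (*-congˡ (zeroˡ _)) (zeroʳ _))) ⟩
        f α n 0 + 0#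
      ≈⟨ +-identityʳ _ ⟩
        f α n 0
      ∎

    f[n,d]≈half^δ*α[0] : ∀ n → f α n (d n) ≈ pow half (δ n) * α 0
    f[n,d]≈half^δ*α[0] n = *-cong (reflexive (≡.cong (pow half) (n∸2*⌊n/2⌋≡n%2 n))) (begin
        sumTo (d n ∸ d n) (λ ν → binom n (2 ℕ.* ν) * binom (d n ∸ ν) (d n) * c α (2 ℕ.* ν))
      ≡⟨ ≡.cong (λ m → sumTo m (λ ν → binom n (2 ℕ.* ν) * binom (d n ∸ ν) (d n) * c α (2 ℕ.* ν)))
                (ℕₚ.n∸n≡0 (d n)) ⟩
        binom n 0 * binom (d n) (d n) * c α 0
      ≈⟨ *-cong (trans (*-cong (+-identityʳ 1#) (binom-n-n (d n))) (*-identityˡ 1#))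
                (trans (*-congʳ (trans (*-identityʳ _) (+-identityʳ 1#))) (*-identityˡ _)) ⟩
        1# * α 0
      ≈⟨ *-identityˡ _ ⟩
        α 0
      ∎)

    c≈two^m*A[half] : ∀ m → c α m ≈ pow two m * A α m half
    c≈two^m*A[half] m = begin
        c α m
      ≈⟨ sumTo≈∑ m _ ⟩
        ∑[ j < suc m ] (binom m j * pow two j * α j)
      ≈⟨ ∑-cong (suc m) (λ j j<1+m → term j (ℕₚ.≤-pred j<1+m)) ⟩
        ∑[ j < suc m ] (pow two m * (binom m j * α j * pow half (m ∸ j)))
      ≈⟨ *-distribˡ-∑ (suc m) _ _ ⟨
        pow two m * ∑[ j < suc m ] (binom m j * α j * pow half (m ∸ j))
      ≈⟨ *-congˡ (A-reversed m half) ⟨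
        pow two m * A α m half
      ∎
      where
      term : ∀ j → j ℕ.≤ m → binom m j * pow two j * α j ≈ pow two m * (binom m j * α j * pow half (m ∸ j))
      term j j≤m = begin
          binom m j * pow two j * α j
        ≈⟨ *-identityʳ _ ⟨
          binom m j * pow two j * α j * 1#
        ≈⟨ *-congˡ (two^n*half^n≈1 (m ∸ j)) ⟨
          binom m j * pow two j * α j * (pow two (m ∸ j) * pow half (m ∸ j))
        ≈⟨ solve 5 (λ b p a q h → b :* p :* a :* (q :* h) := p :* q :* (b :* a :* h)) refl
             (binom m j) (pow two j) (α j) (pow two (m ∸ j)) (pow half (m ∸ j)) ⟩
          pow two j * pow two (m ∸ j) * (binom m j * α j * pow half (m ∸ j))
        ≈⟨ *-congʳ (pow-∸ two j≤m) ⟨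
          pow two m * (binom m j * α j * pow half (m ∸ j))
        ∎

    c≈∑ : ∀ {i N} → i ℕ.≤ N → c α i ≈ ∑[ j < suc N ] (binom i j * pow two j * α j)
    c≈∑ {i} i≤N = trans (sumTo≈∑ i _) (sym (∑-extend _ (s≤s i≤N)
      (λ j i<j _ → trans (*-congʳ (trans (*-congʳ (binom-vanishes i<j)) (zeroˡ _))) (zeroˡ _))))

    two^n*A≈∑c : ∀ n {x z} → two * x ≈ 1# + z →
      pow two n * A α n x ≈ ∑[ i < suc n ] (binom n i * c α i * pow z (n ∸ i))
    two^n*A≈∑c n {x} {z} two*x≈1+z = begin
        pow two n * A α n x
      ≈⟨ *-congˡ (A-reversed n x) ⟩
        pow two n * ∑[ j < suc n ] (binom n j * α j * pow x (n ∸ j))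
      ≈⟨ *-distribˡ-∑ (suc n) _ _ ⟩
        ∑[ j < suc n ] (pow two n * (binom n j * α j * pow x (n ∸ j)))
      ≈⟨ ∑-cong (suc n) (λ j j<1+n → column j (ℕₚ.≤-pred j<1+n)) ⟩
        ∑[ j < suc n ] ∑[ i < suc n ] G i j
      ≈⟨ ∑-comm (suc n) (suc n) G ⟨
        ∑[ i < suc n ] ∑[ j < suc n ] G i j
      ≈⟨ ∑-cong (suc n) (λ i i<1+n → row i (ℕₚ.≤-pred i<1+n)) ⟩
        ∑[ i < suc n ] (binom n i * c α i * pow z (n ∸ i))
      ∎
      where
      G : ℕ → ℕ → Carrier
      G i j = binom n i * binom i j * pow z (n ∸ i) * (pow two j * α j)

      column : ∀ j → j ℕ.≤ n → pow two n * (binom n j * α j * pow x (n ∸ j)) ≈ ∑[ i < suc n ] G i j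
      column j j≤n = begin
          pow two n * (binom n j * α j * pow x (n ∸ j))
        ≈⟨ *-congʳ (pow-∸ two j≤n) ⟩
          pow two j * pow two (n ∸ j) * (binom n j * α j * pow x (n ∸ j))
        ≈⟨ solve 5 (λ p q b a r → p :* q :* (b :* a :* r) := b :* (q :* r) :* (p :* a)) refl
             (pow two j) (pow two (n ∸ j)) (binom n j) (α j) (pow x (n ∸ j)) ⟩
          binom n j * (pow two (n ∸ j) * pow x (n ∸ j)) * (pow two j * α j)
        ≈⟨ *-congʳ (*-congˡ (trans (sym (pow-distrib-* two x (n ∸ j))) (pow-congˡ (n ∸ j) two*x≈1+z))) ⟩
          binom n j * pow (1# + z) (n ∸ j) * (pow two j * α j)
        ≈⟨ *-congʳ (∑-binom*binom*pow z n j≤n) ⟨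
          ∑[ i < suc n ] (binom n i * binom i j * pow z (n ∸ i)) * (pow two j * α j)
        ≈⟨ *-distribʳ-∑ (suc n) _ _ ⟩
          ∑[ i < suc n ] G i j
        ∎

      row : ∀ i → i ℕ.≤ n → ∑[ j < suc n ] G i j ≈ binom n i * c α i * pow z (n ∸ i)
      row i i≤n = begin
          ∑[ j < suc n ] G i j
        ≈⟨ ∑-cong (suc n) (λ j _ → solve 5 (λ a b w p q → a :* b :* w :* (p :* q) := a :* (b :* p :* q) :* w)
             refl (binom n i) (binom i j) (pow z (n ∸ i)) (pow two j) (α j)) ⟩
          ∑[ j < suc n ] (binom n i * (binom i j * pow two j * α j) * pow z (n ∸ i))
        ≈⟨ *-distribʳ-∑ (suc n) _ _ ⟨
          ∑[ j < suc n ] (binom n i * (binom i j * pow two j * α j)) * pow z (n ∸ i)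
        ≈⟨ *-congʳ (*-distribˡ-∑ (suc n) _ _) ⟨
          binom n i * ∑[ j < suc n ] (binom i j * pow two j * α j) * pow z (n ∸ i)
        ≈⟨ *-congʳ (*-congˡ (c≈∑ i≤n)) ⟨
          binom n i * c α i * pow z (n ∸ i)
        ∎

    two^n*F≈∑c : ∀ n u → pow two n * F α n u
      ≈ ∑[ ν < suc (d n) ] (binom n (2 ℕ.* ν) * c α (2 ℕ.* ν) * pow (two * two * u + 1#) (d n ∸ ν))
    two^n*F≈∑c n u = begin
        pow two n * F α n u
      ≈⟨ *-congˡ (sumTo≈∑ (d n) _) ⟩
        pow two n * ∑[ k < suc (d n) ] (f α n k * pow u k)
      ≈⟨ *-distribˡ-∑ (suc (d n)) _ _ ⟩
        ∑[ k < suc (d n) ] (pow two n * (f α n k * pow u k))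
      ≈⟨ ∑-cong (suc (d n)) (λ k k<1+d → term k (ℕₚ.≤-pred k<1+d)) ⟩
        ∑[ k < suc (d n) ] (pow (two * two * u) k * ∑[ ν < suc (d n) ] (W ν * binom (d n ∸ ν) k))
      ≈⟨ ∑-pow*∑-binom (d n) (two * two * u) W ⟩
        ∑[ ν < suc (d n) ] (W ν * pow (two * two * u + 1#) (d n ∸ ν))
      ∎
      where
      W : ℕ → Carrier
      W ν = binom n (2 ℕ.* ν) * c α (2 ℕ.* ν)

      I : ℕ → Carrier
      I k = sumTo (d n ∸ k) (λ ν → binom n (2 ℕ.* ν) * binom (d n ∸ ν) k * c α (2 ℕ.* ν))

      scale : ∀ k → k ℕ.≤ d n → pow two n * pow half (n ∸ 2 ℕ.* k) * pow u k ≈ pow (two * two * u) k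
      scale k k≤d = begin
          pow two n * pow half (n ∸ 2 ℕ.* k) * pow u k
        ≈⟨ *-congʳ (*-congʳ (pow-∸ two (ν≤⌊n/2⌋⇒2*ν≤n n k≤d))) ⟩
          pow two (2 ℕ.* k) * pow two (n ∸ 2 ℕ.* k) * pow half (n ∸ 2 ℕ.* k) * pow u k
        ≈⟨ *-congʳ (trans (*-assoc _ _ _) (trans (*-congˡ (two^n*half^n≈1 (n ∸ 2 ℕ.* k))) (*-identityʳ _))) ⟩
          pow two (2 ℕ.* k) * pow u k
        ≈⟨ *-congʳ (pow-2* two k) ⟩
          pow (two * two) k * pow u k
        ≈⟨ pow-distrib-* (two * two) u k ⟨
          pow (two * two * u) k
        ∎

      I≈∑ : ∀ k → I k ≈ ∑[ ν < suc (d n) ] (W ν * binom (d n ∸ ν) k)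
      I≈∑ k = begin
          I k
        ≈⟨ sumTo≈∑ (d n ∸ k) _ ⟩
          ∑[ ν < suc (d n ∸ k) ] (binom n (2 ℕ.* ν) * binom (d n ∸ ν) k * c α (2 ℕ.* ν))
        ≈⟨ ∑-cong (suc (d n ∸ k)) (λ ν _ → xy∙z≈xz∙y _ _ _) ⟩
          ∑[ ν < suc (d n ∸ k) ] (W ν * binom (d n ∸ ν) k)
        ≈⟨ ∑-extend _ (s≤s (ℕₚ.m∸n≤m (d n) k)) (λ ν d∸k<ν ν<1+d →
             trans (*-congˡ (binom-vanishes {k = k} (m∸k<ν⇒m∸ν<k (ℕₚ.≤-pred ν<1+d) d∸k<ν))) (zeroʳ _)) ⟨
          ∑[ ν < suc (d n) ] (W ν * binom (d n ∸ ν) k)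
        ∎

      term : ∀ k → k ℕ.≤ d n →
        pow two n * (f α n k * pow u k) ≈ pow (two * two * u) k * ∑[ ν < suc (d n) ] (W ν * binom (d n ∸ ν) k)
      term k k≤d = begin
          pow two n * (pow half (n ∸ 2 ℕ.* k) * I k * pow u k)
        ≈⟨ solve 4 (λ a h i w → a :* (h :* i :* w) := a :* h :* w :* i) refl _ _ _ _ ⟩
          pow two n * pow half (n ∸ 2 ℕ.* k) * pow u k * I k
        ≈⟨ *-cong (scale k k≤d) (I≈∑ k) ⟩
          pow (two * two * u) k * ∑[ ν < suc (d n) ] (W ν * binom (d n ∸ ν) k)
        ∎

    ∑binom*α*[x^ν-y^ν]*w : ∀ n x y w →
      sumTo n (λ ν → binom n ν * α (n ∸ ν) * ((pow x ν - pow y ν) * w)) ≈ (A α n x - A α n y) * w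
    ∑binom*α*[x^ν-y^ν]*w n x y w = begin
        sumTo n (λ ν → binom n ν * α (n ∸ ν) * ((pow x ν - pow y ν) * w))
      ≈⟨ sumTo-cong n (λ ν → trans (sym (*-assoc _ _ w)) (*-congʳ (x[y-z]≈xy-xz _ _ _))) ⟩
        sumTo n (λ ν → (a ν * pow x ν - a ν * pow y ν) * w)
      ≈⟨ sumTo≈∑ n _ ⟩
        ∑[ ν < suc n ] ((a ν * pow x ν - a ν * pow y ν) * w)
      ≈⟨ *-distribʳ-∑ (suc n) w _ ⟨
        ∑[ ν < suc n ] (a ν * pow x ν - a ν * pow y ν) * w
      ≈⟨ *-congʳ (∑[f-g]≈∑f-∑g (suc n) _ _) ⟩
        (∑[ ν < suc n ] (a ν * pow x ν) - ∑[ ν < suc n ] (a ν * pow y ν)) * w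
      ≈⟨ *-congʳ (+-cong (sumTo≈∑ n _) (-‿cong (sumTo≈∑ n _))) ⟨
        (A α n x - A α n y) * w
      ∎
      where
      a : ℕ → Carrier
      a ν = binom n ν * α (n ∸ ν)

    -- Symmetric sequences

    module _ (symmetric : ∀ m x → A α m (1# - x) ≈ pow (- 1#) m * A α m x) where

      c[odd]≈0 : ∀ ν → c α (suc (2 ℕ.* ν)) ≈ 0#
      c[odd]≈0 ν = trans (c≈two^m*A[half] m) (trans (*-congˡ A[half]≈0) (zeroʳ _))
        where
        m : ℕ
        m = suc (2 ℕ.* ν)
        A[half]≈0 : A α m half ≈ 0#
        A[half]≈0 = x≈-x⇒x≈0 (begin
            A α m half
          ≈⟨ A-congʳ m 1-half≈half ⟨
            A α m (1# - half)
          ≈⟨ symmetric m half ⟩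
            - 1# * pow (- 1#) (2 ℕ.* ν) * A α m half
          ≈⟨ *-congʳ (trans (*-congˡ ([-1]^[2*m]≈1 ν)) (*-identityʳ _)) ⟩
            - 1# * A α m half
          ≈⟨ -1*x≈-x _ ⟩
            - A α m half
          ∎)

      two^n*A≈∑c[even] : ∀ n {x y} → two * x ≈ 1# + y →
        pow two n * A α n x ≈ ∑[ ν < suc (d n) ] (binom n (2 ℕ.* ν) * c α (2 ℕ.* ν) * pow y (n ∸ 2 ℕ.* ν))
      two^n*A≈∑c[even] n {x} {y} two*x≈1+y = begin
          pow two n * A α n x
        ≈⟨ two^n*A≈∑c n two*x≈1+y ⟩
          ∑< (suc n) g
        ≈⟨ ∑-extend g (1+n≤2*[1+⌊n/2⌋] n)
             (λ i n<i _ → trans (*-congʳ (trans (*-congʳ (binom-vanishes n<i)) (zeroˡ _))) (zeroˡ _)) ⟨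
          ∑< (2 ℕ.* suc (d n)) g
        ≈⟨ ∑-pairs (suc (d n)) g ⟩
          ∑[ ν < suc (d n) ] (g (2 ℕ.* ν) + g (suc (2 ℕ.* ν)))
        ≈⟨ ∑-cong (suc (d n)) (λ ν _ → trans (+-congˡ (g[odd]≈0 ν)) (+-identityʳ _)) ⟩
          ∑[ ν < suc (d n) ] g (2 ℕ.* ν)
        ∎
        where
        g : ℕ → Carrier
        g i = binom n i * c α i * pow y (n ∸ i)
        g[odd]≈0 : ∀ ν → g (suc (2 ℕ.* ν)) ≈ 0#
        g[odd]≈0 ν = trans (*-congʳ (trans (*-congˡ (c[odd]≈0 ν)) (zeroʳ _))) (zeroˡ _)

      A≈[two*x-1]^δ*F[x[x-1]] : ∀ n x → A α n x ≈ pow (two * x - 1#) (δ n) * F α n (x * (x - 1#))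
      A≈[two*x-1]^δ*F[x[x-1]] n x = two^n*-cancelˡ n (begin
          pow two n * A α n x
        ≈⟨ two^n*A≈∑c[even] n two*x≈1+y ⟩
          ∑[ ν < suc (d n) ] (W ν * pow y (n ∸ 2 ℕ.* ν))
        ≈⟨ ∑-cong (suc (d n)) (λ ν ν<1+d → trans (*-congˡ (y^[n-2ν] ν (ℕₚ.≤-pred ν<1+d))) (x∙yz≈y∙xz _ _ _)) ⟩
          ∑[ ν < suc (d n) ] (pow y (δ n) * (W ν * pow (two * two * u + 1#) (d n ∸ ν)))
        ≈⟨ *-distribˡ-∑ (suc (d n)) _ _ ⟨
          pow y (δ n) * ∑[ ν < suc (d n) ] (W ν * pow (two * two * u + 1#) (d n ∸ ν))
        ≈⟨ *-congˡ (two^n*F≈∑c n u) ⟨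
          pow y (δ n) * (pow two n * F α n u)
        ≈⟨ x∙yz≈y∙xz _ _ _ ⟩
          pow two n * (pow y (δ n) * F α n u)
        ∎)
        where
        y u : Carrier
        y = two * x - 1#
        u = x * (x - 1#)
        W : ℕ → Carrier
        W ν = binom n (2 ℕ.* ν) * c α (2 ℕ.* ν)
        two*x≈1+y : two * x ≈ 1# + y
        two*x≈1+y = sym (begin
            1# + (two * x - 1#)
          ≈⟨ +-comm 1# _ ⟩
            (two * x - 1#) + 1#
          ≈⟨ +-assoc _ _ _ ⟩
            two * x + (- 1# + 1#)
          ≈⟨ +-congˡ (-‿inverseˡ 1#) ⟩
            two * x + 0#
          ≈⟨ +-identityʳ _ ⟩
            two * x
          ∎)
        y^[n-2ν] : ∀ ν → ν ℕ.≤ d n → pow y (n ∸ 2 ℕ.* ν) ≈ pow y (δ n) * pow (two * two * u + 1#) (d n ∸ ν)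
        y^[n-2ν] ν ν≤d = begin
            pow y (n ∸ 2 ℕ.* ν)
          ≡⟨ ≡.cong (pow y) (n∸2*ν≡n%2+2*[⌊n/2⌋∸ν] n ν≤d) ⟩
            pow y (δ n ℕ.+ 2 ℕ.* (d n ∸ ν))
          ≈⟨ pow-+ y (δ n) _ ⟩
            pow y (δ n) * pow y (2 ℕ.* (d n ∸ ν))
          ≈⟨ *-congˡ (trans (pow-2* y (d n ∸ ν)) (pow-congˡ (d n ∸ ν) ([two*x-1]^2≈4x[x-1]+1 x))) ⟩
            pow y (δ n) * pow (two * two * u + 1#) (d n ∸ ν)
          ∎

      f[n,0]≈[-1]^n*α[n] : ∀ n → f α n 0 ≈ pow (- 1#) n * α n
      f[n,0]≈[-1]^n*α[n] n = sym (begin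
          pow (- 1#) n * α n
        ≈⟨ *-cong ([-1]^n≈[-1]^δn n) (sym (A-at-0 n)) ⟩
          ε * A α n 0#
        ≈⟨ *-congˡ (A≈[two*x-1]^δ*F[x[x-1]] n 0#) ⟩
          ε * (pow (two * 0# - 1#) (δ n) * F α n (0# * (0# - 1#)))
        ≈⟨ *-congˡ (*-cong (pow-congˡ (δ n) (trans (+-congʳ (zeroʳ two)) (+-identityˡ _)))
                           (trans (F-congʳ n (zeroˡ _)) (F-at-0 n))) ⟩
          ε * (ε * f α n 0)
        ≈⟨ *-assoc ε ε _ ⟨
          ε * ε * f α n 0
        ≈⟨ *-congʳ ([-1]^k*[-1]^k≈1 (δ n)) ⟩
          1# * f α n 0
        ≈⟨ *-identityˡ _ ⟩
          f α n 0
        ∎)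
        where
        ε : Carrier
        ε = pow (- 1#) (δ n)

      A[φ]≈s^δ*F[1] : ∀ {s} → s * s ≈ fromℕ 5 → ∀ n → A α n (φ s) ≈ pow s (δ n) * F α n 1#
      A[φ]≈s^δ*F[1] {s} s*s≈5 n = trans (A≈[two*x-1]^δ*F[x[x-1]] n (φ s))
        (*-cong (pow-congˡ (δ n) (two*φ-1≈s s)) (F-congʳ n (φ*[φ-1]≈1 s*s≈5)))

      A[1-φ]≈[-1]^δ*A[φ] : ∀ s n → A α n (1# - φ s) ≈ pow (- 1#) (δ n) * A α n (φ s)
      A[1-φ]≈[-1]^δ*A[φ] s n = trans (symmetric n (φ s)) (*-congʳ ([-1]^n≈[-1]^δn n))

      ∑binom*α*Fib≈two*F[1] : ∀ {s} → s * s ≈ fromℕ 5 → (s≉0 : ¬ (s ≈ 0#)) → ∀ n → δ n ≡ 1 →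
        sumTo n (λ ν → binom n ν * α (n ∸ ν) * Fib s s≉0 ν) ≈ two * F α n 1#
      ∑binom*α*Fib≈two*F[1] {s} s*s≈5 s≉0 n δn≡1 = begin
          sumTo n (λ ν → binom n ν * α (n ∸ ν) * Fib s s≉0 ν)
        ≈⟨ ∑binom*α*[x^ν-y^ν]*w n (φ s) (1# - φ s) w ⟩
          (A₊ - A α n (1# - φ s)) * w
        ≈⟨ *-congʳ (+-congˡ (-‿cong A₋≈-A₊)) ⟩
          (A₊ - - A₊) * w
        ≈⟨ *-congʳ (trans (+-congˡ (-‿involutive A₊)) (x+x≈two*x A₊)) ⟩
          two * A₊ * w
        ≈⟨ *-congʳ (*-congˡ A₊≈s*F[1]) ⟩
          two * (s * F α n 1#) * w
        ≈⟨ solve 4 (λ t s g w → t :* (s :* g) :* w := t :* g :* (s :* w)) refl two s (F α n 1#) w ⟩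
          two * F α n 1# * (s * w)
        ≈⟨ *-congˡ (inv-cor s s≉0) ⟩
          two * F α n 1# * 1#
        ≈⟨ *-identityʳ _ ⟩
          two * F α n 1#
        ∎
        where
        w A₊ : Carrier
        w = inv s s≉0
        A₊ = A α n (φ s)
        A₋≈-A₊ : A α n (1# - φ s) ≈ - A₊
        A₋≈-A₊ = trans (A[1-φ]≈[-1]^δ*A[φ] s n)
          (trans (*-congʳ (trans (reflexive (≡.cong (pow (- 1#)) δn≡1)) (*-identityʳ (- 1#)))) (-1*x≈-x A₊))
        A₊≈s*F[1] : A₊ ≈ s * F α n 1#
        A₊≈s*F[1] = trans (A[φ]≈s^δ*F[1] s*s≈5 n)
          (*-congʳ (trans (reflexive (≡.cong (pow s) δn≡1)) (*-identityʳ s)))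

      ∑binom*α*Fib≈0 : ∀ s (s≉0 : ¬ (s ≈ 0#)) n → δ n ≡ 0 →
        sumTo n (λ ν → binom n ν * α (n ∸ ν) * Fib s s≉0 ν) ≈ 0#
      ∑binom*α*Fib≈0 s s≉0 n δn≡0 = begin
          sumTo n (λ ν → binom n ν * α (n ∸ ν) * Fib s s≉0 ν)
        ≈⟨ ∑binom*α*[x^ν-y^ν]*w n (φ s) (1# - φ s) (inv s s≉0) ⟩
          (A α n (φ s) - A α n (1# - φ s)) * inv s s≉0
        ≈⟨ *-congʳ (+-congˡ (-‿cong A₋≈A₊)) ⟩
          (A α n (φ s) - A α n (φ s)) * inv s s≉0
        ≈⟨ *-congʳ (-‿inverseʳ _) ⟩
          0# * inv s s≉0
        ≈⟨ zeroˡ _ ⟩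
          0#
        ∎
        where
        A₋≈A₊ : A α n (1# - φ s) ≈ A α n (φ s)
        A₋≈A₊ = trans (A[1-φ]≈[-1]^δ*A[φ] s n)
          (trans (*-congʳ (reflexive (≡.cong (pow (- 1#)) δn≡0))) (*-identityˡ _))


theorem4p3 : (K : Char0Field) → let open Char0Field K in let open Theory K in
    (s : Carrier) → s * s ≈ fromℕ 5 → (s≉0 : ¬ (s ≈ 0#)) →
    (α : ℕ → Carrier) →
    (∀ (m : ℕ) (x : Carrier) → A α m (1# - x) ≈ pow (- 1#) m * A α m x) →
    (n : ℕ) →
      (∀ (x : Carrier) → A α n x ≈ pow (two * x - 1#) (δ n) * F α n (x * (x - 1#)))
      × (f α n 0 ≈ pow (- 1#) n * α n)
      × (f α n (d n) ≈ pow half (δ n) * α 0)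
      × (A α n (φ s) ≈ pow s (δ n) * F α n 1#)
      × (δ n ≡ 1 → sumTo n (λ ν → binom n ν * α (n ∸ ν) * Fib s s≉0 ν) ≈ two * F α n 1#)
      × (δ n ≡ 0 → sumTo n (λ ν → binom n ν * α (n ∸ ν) * Fib s s≉0 ν) ≈ 0#)
theorem4p3 K s s*s≈5 s≉0 α symmetric n =
    A≈[two*x-1]^δ*F[x[x-1]] K α symmetric n
  , f[n,0]≈[-1]^n*α[n] K α symmetric n
  , f[n,d]≈half^δ*α[0] K α n
  , A[φ]≈s^δ*F[1] K α symmetric s*s≈5 n
  , ∑binom*α*Fib≈two*F[1] K α symmetric s*s≈5 s≉0 n
  , ∑binom*α*Fib≈0 K α symmetric s s≉0 n
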